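{- Let $\mathcal{J}$ be a maximal ideal on $\mathbb{N}$ and define $\delta:\mathcal{P}(\mathbb{N})\to[0,1]$ by $\delta(A)=\lim^{\mathcal{J}}\frac{|A\cap\{1,\dots,n\}|}{n}$. Then $\mathcal{Z}_\delta\neq t(\mathcal{I})$ for every maximal ideal $\mathcal{I}$ on $\mathbb{N}$.
   Context: For $A\subseteq\mathbb{N}$ and $k\in\mathbb{Z}$, $A+k$ denotes $\{a+k:a\in A\}\cap\mathbb{N}$. An ideal on $\mathbb{N}$ is a family $\mathcal{I}\subseteq\mathcal{P}(\mathbb{N})$ closed under finite unions and subsets, containing all finite subsets of $\mathbb{N}$, with $\mathbb{N}\notin\mathcal{I}$; it is maximal if it is not properly contained in another ideal on $\mathbb{N}$. For an ideal $\mathcal{J}$, a real sequence $(x_n)$ is $\mathcal{J}$-convergent to $L$, written $L=\lim^{\mathcal{J}}x_n$, if $\{n\in\mathbb{N}:|x_n-L|\ge\varepsilon\}\in\mathcal{J}$ for every $\varepsilon>0$ (for maximal $\mathcal{J}$ every bounded sequence has a unique such limit). $\mathcal{Z}_\delta=\{A\subseteq\mathbb{N}:\delta(A)=0\}$. For an ideal $\mathcal{I}$, $t(\mathcal{I})=\{A\subseteq\mathbb{N}:A+k\in\mathcal{I}\text{ for every }k\in\mathbb{Z}\}$. -}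

module Defs where

open import Data.Bool using (Bool; true; false; _∨_; if_then_else_)
open import Data.Nat using (ℕ; zero; suc; _<_)
open import Data.Integer as ℤ using (ℤ; +_; -[1+_])
open import Data.Rational using (ℚ; _/_; ∣_∣; _-_; 0ℚ; Positive) renaming (_≤_ to _≤ℚ_)
open import Data.Product using (Σ; _×_; ∃)
open import Data.Empty using (⊥)
open import Relation.Binary.PropositionalEquality using (_≡_)

-- Convention: the paper's ℕ = {1,2,3,...}.  Agda's natural number i encodes
-- the paper's number i+1.  A subset of the paper's ℕ is a function ℕ → Bool
-- (decidable membership is needed to count |A ∩ {1..n}|; classically every
-- subset is of this form).

Subset : Set
Subset = ℕ → Bool

_∈_ : ℕ → Subset → Set
n ∈ A = A n ≡ true

_⊆_ : Subset → Subset → Set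
A ⊆ B = ∀ n → n ∈ A → n ∈ B

_∪_ : Subset → Subset → Subset
(A ∪ B) n = A n ∨ B n

fullℕ : Subset
fullℕ _ = true

Finite : Subset → Set
Finite A = ∃ λ m → ∀ n → n ∈ A → n < m

Family : Set₁
Family = Subset → Set

record IsIdeal (I : Family) : Set where
  field
    union-closed  : ∀ A B → I A → I B → I (A ∪ B)
    subset-closed : ∀ A B → A ⊆ B → I B → I A
    finite-in     : ∀ A → Finite A → I A
    proper        : I fullℕ → ⊥

IsMaximalIdeal : Family → Set₁
IsMaximalIdeal I = IsIdeal I × (∀ (I' : Family) → IsIdeal I' → (∀ A → I A → I' A) → ∀ A → I' A → I A)

-- A + k = {a + k : a ∈ A} ∩ ℕ  (shift is the same in the encoded coordinates)
shift : Subset → ℤ → Subset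
shift A k m with (+ m) ℤ.- k
... | + j      = A j
... | -[1+ _ ] = false

t : Family → Family
t I A = ∀ (k : ℤ) → I (shift A k)

-- count A i = |{ j < i : j ∈ A }|, i.e. |A ∩ {1,…,i}| in paper coordinates
count : Subset → ℕ → ℕ
count A zero = zero
count A (suc i) = (if A i then 1 else 0) Data.Nat.+ count A i

-- the paper's n-th density ratio, n = i+1:  |A ∩ {1..n}| / n
ratio : Subset → ℕ → ℚ
ratio A i = (+ count A (suc i)) / suc i

JConverges : Family → (ℕ → ℚ) → ℚ → Set
JConverges J x L = ∀ (ε : ℚ) → Positive ε → J (λ n → isGe (x n) ε)
  where
  isGe : ℚ → ℚ → Bool
  isGe q e = Relation.Nullary.Decidable.⌊ e Data.Rational.≤? ∣ q - L ∣ ⌋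
    where import Relation.Nullary.Decidable

-- Z_δ = {A : δ(A) = 0}, δ(A) = lim^J ratio A; for maximal J the J-limit is
-- unique, so δ(A) = 0 iff ratio A is J-convergent to 0.
Zδ : Family → Family
Zδ J A = JConverges J (ratio A) 0ℚ

_≐_ : Family → Family → Set
F ≐ G = ∀ A → (F A → G A) × (G A → F A)

{-# OPTIONS --safe #-}
-- Split ℕ into the dyadic blocks [2ʲ, 2ʲ⁺¹) and let B be the union of the blocks with j even.
-- A shift by k moves only the points within distance |k| of a block boundary across a
-- boundary, and those points have density zero.  So if δ-null sets were exactly t(I), every
-- δ-null set would lie in I, hence B ∈ I would give B + k ⊆ B ∪ (null set) ∈ I for all k,
-- i.e. B ∈ t(I) = Z_δ; likewise for its complement.  But B and ℕ ∖ B both have lower density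
-- at least 1/8, so neither lies in Z_δ, while a maximal ideal contains one of them.
module Submission where

open import Algebra.Bundles using (AbelianGroup)
open import Data.Bool using (Bool; true; false; not; _∧_; _∨_)
open import Data.Bool.Properties
  using (T-≡; ∧-conicalˡ; ∧-conicalʳ; ∧-distribʳ-∨; ∧-inverseˡ; ∨-zeroʳ)
open import Data.Integer as ℤ using (+[1+_]; -[1+_])
import Data.Integer.Properties as ℤ
open import Data.Nat
open import Data.Nat.Coprimality using (Coprime; 1-coprimeTo)
open import Data.Nat.Logarithm using (⌊log₂_⌋; ⌊log₂⌋-mono-≤; ⌊log₂⌊n/2⌋⌋≡⌊log₂n⌋∸1; ⌊log₂[2^n]⌋≡n)
open import Data.Nat.Properties
open import Data.Nat.Tactic.RingSolver using (solve-∀)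
open import Data.Product using (∃; _×_; _,_; proj₁; proj₂)
open import Data.Rational as ℚ using (mkℚ; 0ℚ; toℚᵘ) renaming (_≤_ to _≤ℚ_)
import Data.Rational.Properties as ℚ
import Data.Rational.Unnormalised as ℚᵘ
import Data.Rational.Unnormalised.Properties as ℚᵘ
open import Data.Sum using (_⊎_; inj₁; inj₂)
open import Function using (_∘_)
open import Function.Bundles using (_⇔_; mk⇔; Equivalence)
open import Relation.Binary.PropositionalEquality
open import Relation.Nullary using (¬_; yes; no; contradiction)
open import Relation.Nullary.Decidable using (⌊_⌋; toWitness; fromWitness)

open import Defs

open import Algebra.Properties.Group (AbelianGroup.group ℤ.+-0-abelianGroup) using (//-rightDividesˡ)

_∩_ : Subset → Subset → Subset
(A ∩ B) n = A n ∧ B n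

∁ : Subset → Subset
∁ A n = not (A n)

maximal⇒∁∈ : ∀ {I} → IsMaximalIdeal I → ∀ X → ¬ I X → I (∁ X)
maximal⇒∁∈ {I} (idealI , maximal) X X∉I = maximal trace traceIdeal I⊆trace (∁ X) ∁X∈trace
  where
  open IsIdeal idealI
  trace : Family
  trace A = I (A ∩ X)
  ∩-⊆ˡ : ∀ A → (A ∩ X) ⊆ A
  ∩-⊆ˡ A n = ∧-conicalˡ (A n) (X n)
  I⊆trace : ∀ A → I A → trace A
  I⊆trace A = subset-closed (A ∩ X) A (∩-⊆ˡ A)
  traceIdeal : IsIdeal trace
  traceIdeal = record
    { union-closed  = λ A B A∈ B∈ → subset-closed ((A ∪ B) ∩ X) ((A ∩ X) ∪ (B ∩ X))
                        (λ n → trans (sym (∧-distribʳ-∨ (X n) (A n) (B n)))) (union-closed _ _ A∈ B∈)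
    ; subset-closed = λ A B A⊆B → subset-closed (A ∩ X) (B ∩ X)
                        (λ n n∈ → cong₂ _∧_ (A⊆B n (∩-⊆ˡ A n n∈)) (∧-conicalʳ (A n) (X n) n∈))
    ; finite-in     = λ A (m , A<m) → finite-in (A ∩ X) (m , λ n n∈ → A<m n (∩-⊆ˡ A n n∈))
    ; proper        = λ full∈ → X∉I (subset-closed X (fullℕ ∩ X) (λ _ n∈ → n∈) full∈)
    }
  ∁X∈trace : trace (∁ X)
  ∁X∈trace = finite-in (∁ X ∩ X) (0 , λ n n∈ → contradiction (trans (sym n∈) (∧-inverseˡ (X n))) λ ())

t⊆ : ∀ {I} → IsIdeal I → ∀ A → t I A → I A
t⊆ idealI A A∈tI = IsIdeal.subset-closed idealI A (shift A (ℤ.+ 0))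
  (λ n n∈A → subst (_∈ A) (sym (+-identityʳ n)) n∈A) (A∈tI (ℤ.+ 0))

⌊n/2⌋<⇐<n+n : ∀ {m} n → m < n + n → ⌊ m /2⌋ < n
⌊n/2⌋<⇐<n+n {m} n m<n+n = ≰⇒> λ n≤⌊m/2⌋ → <⇒≱ m<n+n (begin
  n + n                 ≤⟨ +-mono-≤ n≤⌊m/2⌋ (≤-trans n≤⌊m/2⌋ (⌊n/2⌋≤⌈n/2⌉ m)) ⟩
  ⌊ m /2⌋ + ⌈ m /2⌉     ≡⟨ ⌊n/2⌋+⌈n/2⌉≡n m ⟩
  m                     ∎)
  where open ≤-Reasoning

2^suc≡2^+2^ : ∀ j → 2 ^ suc j ≡ 2 ^ j + 2 ^ j
2^suc≡2^+2^ j = cong (_+_ (2 ^ j)) (+-identityʳ (2 ^ j))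

⌊log₂⌋≤ : ∀ j {m} → m < 2 ^ suc j → ⌊log₂ m ⌋ ≤ j
⌊log₂⌋≤ zero {0} _ = z≤n
⌊log₂⌋≤ zero {1} _ = z≤n
⌊log₂⌋≤ zero {2+ _} (s≤s (s≤s ()))
⌊log₂⌋≤ (suc j) {m} m<2^j+2 = begin
  ⌊log₂ m ⌋                ≤⟨ m≤n+m∸n ⌊log₂ m ⌋ 1 ⟩
  1 + (⌊log₂ m ⌋ ∸ 1)      ≡⟨ cong suc (sym (⌊log₂⌊n/2⌋⌋≡⌊log₂n⌋∸1 m)) ⟩
  1 + ⌊log₂ ⌊ m /2⌋ ⌋      ≤⟨ s≤s (⌊log₂⌋≤ j ⌊m/2⌋<2^j+1) ⟩
  suc j                    ∎
  where
  open ≤-Reasoning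
  ⌊m/2⌋<2^j+1 : ⌊ m /2⌋ < 2 ^ suc j
  ⌊m/2⌋<2^j+1 = ⌊n/2⌋<⇐<n+n (2 ^ suc j) (subst (m <_) (2^suc≡2^+2^ (suc j)) m<2^j+2)

⌊log₂⌋≡ : ∀ j {m} → 2 ^ j ≤ m → m < 2 ^ j + 2 ^ j → ⌊log₂ m ⌋ ≡ j
⌊log₂⌋≡ j {m} 2^j≤m m<2^j+2^j =
  ≤-antisym (⌊log₂⌋≤ j (subst (m <_) (sym (2^suc≡2^+2^ j)) m<2^j+2^j))
            (subst (_≤ ⌊log₂ m ⌋) (⌊log₂[2^n]⌋≡n j) (⌊log₂⌋-mono-≤ 2^j≤m))

dyadicBlock : ∀ n → ∃ λ j → 2 ^ j ≤ suc n × suc n < 2 ^ suc j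
dyadicBlock zero = 0 , ≤-refl , s≤s (s≤s z≤n)
dyadicBlock (suc n) with dyadicBlock n
... | j , 2^j≤ , <2^j+1 with suc (suc n) <? 2 ^ suc j
...   | yes <2^j+1' = j , m≤n⇒m≤1+n 2^j≤ , <2^j+1'
...   | no ≮ = suc j , ≤-reflexive (sym 2+n≡) , subst (_< 2 ^ suc (suc j)) (sym 2+n≡)
                (^-monoʳ-< 2 (s≤s (s≤s z≤n)) (n<1+n (suc j)))
  where
  2+n≡ : suc (suc n) ≡ 2 ^ suc j
  2+n≡ = ≤-antisym <2^j+1 (≮⇒≥ ≮)

count-+-≤ : ∀ A L a → count A (L + a) ≤ L + count A a
count-+-≤ A zero    a = ≤-refl
count-+-≤ A (suc L) a with A (L + a)
... | true  = s≤s (count-+-≤ A L a)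
... | false = m≤n⇒m≤1+n (count-+-≤ A L a)

count≤count-+ : ∀ A L a → count A a ≤ count A (L + a)
count≤count-+ A zero    a = ≤-refl
count≤count-+ A (suc L) a with A (L + a)
... | true  = m≤n⇒m≤1+n (count≤count-+ A L a)
... | false = count≤count-+ A L a

count-mono : ∀ A {m n} → m ≤ n → count A m ≤ count A n
count-mono A {m} {n} m≤n = subst (λ k → count A m ≤ count A k) (m∸n+n≡m m≤n) (count≤count-+ A (n ∸ m) m)

count-≤ : ∀ A n → count A n ≤ n
count-≤ A n = subst₂ _≤_ (cong (count A) (+-identityʳ n)) (+-identityʳ n) (count-+-≤ A n 0)

count-all : ∀ A L a → (∀ i → a ≤ i → i < L + a → i ∈ A) → count A (L + a) ≡ L + count A a
count-all A zero    a _  = refl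
count-all A (suc L) a all rewrite all (L + a) (m≤n+m a L) ≤-refl =
  cong suc (count-all A L a λ i a≤i i<L+a → all i a≤i (m≤n⇒m≤1+n i<L+a))

count-none : ∀ A L a → (∀ i → a ≤ i → i < L + a → A i ≡ false) → count A (L + a) ≡ count A a
count-none A zero    a _    = refl
count-none A (suc L) a none rewrite none (L + a) (m≤n+m a L) ≤-refl =
  count-none A L a λ i a≤i i<L+a → none i a≤i (m≤n⇒m≤1+n i<L+a)

dyadicUnion : (ℕ → Bool) → Subset
dyadicUnion f m = f ⌊log₂ m ⌋

2^≤count-dyadicUnion : ∀ f j → f j ≡ true → 2 ^ j ≤ count (dyadicUnion f) (2 ^ suc j)
2^≤count-dyadicUnion f j fj = begin
  2 ^ j                                           ≤⟨ m≤m+n (2 ^ j) _ ⟩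
  2 ^ j + count (dyadicUnion f) (2 ^ j)           ≡⟨ sym (count-all (dyadicUnion f) (2 ^ j) (2 ^ j) block⊆) ⟩
  count (dyadicUnion f) (2 ^ j + 2 ^ j)           ≡⟨ cong (count (dyadicUnion f)) (sym (2^suc≡2^+2^ j)) ⟩
  count (dyadicUnion f) (2 ^ suc j)               ∎
  where
  open ≤-Reasoning
  block⊆ : ∀ i → 2 ^ j ≤ i → i < 2 ^ j + 2 ^ j → i ∈ dyadicUnion f
  block⊆ i 2^j≤i i< = trans (cong f (⌊log₂⌋≡ j 2^j≤i i<)) fj

≤count*8-dyadicUnion : ∀ f i {N} → f i ≡ true → 2 ^ suc i ≤ N → N < 2 ^ (3 + i) →
                       N ≤ count (dyadicUnion f) N * 8
≤count*8-dyadicUnion f i {N} fi 2^i+1≤N N<2^i+3 = begin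
  N                                    ≤⟨ <⇒≤ N<2^i+3 ⟩
  2 ^ (3 + i)                          ≡⟨ ^-distribˡ-+-* 2 3 i ⟩
  8 * 2 ^ i                            ≤⟨ *-monoʳ-≤ 8 (2^≤count-dyadicUnion f i fi) ⟩
  8 * count (dyadicUnion f) (2 ^ suc i) ≤⟨ *-monoʳ-≤ 8 (count-mono (dyadicUnion f) 2^i+1≤N) ⟩
  8 * count (dyadicUnion f) N          ≡⟨ *-comm 8 (count (dyadicUnion f) N) ⟩
  count (dyadicUnion f) N * 8          ∎
  where open ≤-Reasoning

dyadicUnion-dense : ∀ f → (∀ j → f j ≡ true ⊎ f (suc j) ≡ true) →
                    ∀ n → 3 ≤ n → suc n ≤ count (dyadicUnion f) (suc n) * 8
dyadicUnion-dense f f-often n (s≤s (s≤s (s≤s _))) with dyadicBlock n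
... | 0 , _ , s≤s (s≤s ())
... | 1 , _ , s≤s (s≤s (s≤s (s≤s ())))
... | suc (suc i) , 2^i+2≤N , N<2^i+3 with f-often i
...   | inj₁ fi  = ≤count*8-dyadicUnion f i fi (≤-trans (^-monoʳ-≤ 2 (n≤1+n (suc i))) 2^i+2≤N) N<2^i+3
...   | inj₂ fi+1 = ≤count*8-dyadicUnion f (suc i) fi+1 2^i+2≤N
                      (<-≤-trans N<2^i+3 (^-monoʳ-≤ 2 (n≤1+n (3 + i))))

dyadicBoundary : ℕ → Subset
dyadicBoundary K m = not ⌊ ⌊log₂ (m ∸ K) ⌋ ≟ ⌊log₂ (m + K) ⌋ ⌋

dyadicBoundary-interior : ∀ K j i → 2 ^ j + K ≤ i → i + K < 2 ^ j + 2 ^ j → dyadicBoundary K i ≡ false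
dyadicBoundary-interior K j i 2^j+K≤i i+K< with ⌊log₂ (i ∸ K) ⌋ ≟ ⌊log₂ (i + K) ⌋
... | yes _  = refl
... | no log≢ = contradiction (trans (⌊log₂⌋≡ j 2^j≤i∸K i∸K<) (sym (⌊log₂⌋≡ j 2^j≤i+K i+K<))) log≢
  where
  2^j≤i∸K : 2 ^ j ≤ i ∸ K
  2^j≤i∸K = m+n≤o⇒m≤o∸n (2 ^ j) 2^j+K≤i
  i∸K< : i ∸ K < 2 ^ j + 2 ^ j
  i∸K< = ≤-<-trans (≤-trans (m∸n≤m i K) (m≤m+n i K)) i+K<
  2^j≤i+K : 2 ^ j ≤ i + K
  2^j≤i+K = ≤-trans (m≤m+n (2 ^ j) K) (≤-trans 2^j+K≤i (m≤m+n i K))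

-- Inside the block [2ʲ, 2ʲ⁺¹) only its first and last K points can be boundary points.
count-dyadicBoundary-step : ∀ K j →
  count (dyadicBoundary K) (2 ^ suc j) ≤ (K + K) + count (dyadicBoundary K) (2 ^ j)
count-dyadicBoundary-step K j with 2 ^ j ≤? K + K
... | yes a≤2K = begin
  count ∂ (2 ^ suc j)   ≡⟨ cong (count ∂) (2^suc≡2^+2^ j) ⟩
  count ∂ (a + a)       ≤⟨ count-+-≤ ∂ a a ⟩
  a + count ∂ a         ≤⟨ +-monoˡ-≤ (count ∂ a) a≤2K ⟩
  (K + K) + count ∂ a   ∎
  where open ≤-Reasoning; ∂ = dyadicBoundary K; a = 2 ^ j
... | no a≰2K = begin
  count ∂ (2 ^ suc j)             ≡⟨ cong (count ∂) 2^suc≡ ⟩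
  count ∂ (K + (M + (K + a)))     ≤⟨ count-+-≤ ∂ K _ ⟩
  K + count ∂ (M + (K + a))       ≡⟨ cong (K +_) (count-none ∂ M (K + a) interior) ⟩
  K + count ∂ (K + a)             ≤⟨ +-monoʳ-≤ K (count-+-≤ ∂ K a) ⟩
  K + (K + count ∂ a)             ≡⟨ +-assoc K K (count ∂ a) ⟨
  (K + K) + count ∂ a             ∎
  where
  open ≤-Reasoning
  ∂ = dyadicBoundary K
  a = 2 ^ j
  M = a ∸ (K + K)
  M+2K≡a : M + (K + K) ≡ a
  M+2K≡a = m∸n+n≡m (≰⇒≥ a≰2K)
  2^suc≡ : 2 ^ suc j ≡ K + (M + (K + a))
  2^suc≡ = begin-equality
    2 ^ suc j                  ≡⟨ 2^suc≡2^+2^ j ⟩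
    a + a                      ≡⟨ cong (_+ a) M+2K≡a ⟨
    M + (K + K) + a            ≡⟨ rearrange M K a ⟩
    K + (M + (K + a))          ∎
    where
    rearrange : ∀ m k x → m + (k + k) + x ≡ k + (m + (k + x))
    rearrange = solve-∀
  interior : ∀ i → K + a ≤ i → i < M + (K + a) → ∂ i ≡ false
  interior i K+a≤i i< = dyadicBoundary-interior K j i (subst (_≤ i) (+-comm K a) K+a≤i) (begin-strict
    i + K                      <⟨ +-monoˡ-< K i< ⟩
    M + (K + a) + K            ≡⟨ rearrange M K a ⟩
    M + (K + K) + a            ≡⟨ cong (_+ a) M+2K≡a ⟩
    a + a                      ∎)
    where
    rearrange : ∀ m k x → m + (k + x) + k ≡ m + (k + k) + x
    rearrange = solve-∀

count-dyadicBoundary : ∀ K j → count (dyadicBoundary K) (2 ^ j) ≤ 1 + j * (K + K)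
count-dyadicBoundary K zero    = count-≤ (dyadicBoundary K) 1
count-dyadicBoundary K (suc j) = begin
  count ∂ (2 ^ suc j)              ≤⟨ count-dyadicBoundary-step K j ⟩
  (K + K) + count ∂ (2 ^ j)        ≤⟨ +-monoʳ-≤ (K + K) (count-dyadicBoundary K j) ⟩
  (K + K) + (1 + j * (K + K))      ≡⟨ +-suc (K + K) (j * (K + K)) ⟩
  1 + suc j * (K + K)              ∎
  where open ≤-Reasoning; ∂ = dyadicBoundary K

*[2+4*]<2^4* : ∀ c → c * (2 + 4 * c) < 2 ^ (4 * c)
*[2+4*]<2^4* zero    = z<s
*[2+4*]<2^4* (suc c) = begin-strict
  suc c * (2 + 4 * suc c)                            ≡⟨ cong (λ k → suc c * (2 + k)) (*-suc 4 c) ⟩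
  suc c * (6 + 4 * c)                                <⟨ m<m+n _ z<s ⟩
  suc c * (6 + 4 * c) + suc (9 + c * (22 + 60 * c))  ≡⟨ expand c ⟩
  16 * suc (c * (2 + 4 * c))                         ≤⟨ *-monoʳ-≤ 16 (*[2+4*]<2^4* c) ⟩
  16 * 2 ^ (4 * c)                                   ≡⟨ ^-distribˡ-+-* 2 4 (4 * c) ⟨
  2 ^ (4 + 4 * c)                                    ≡⟨ cong (2 ^_) (*-suc 4 c) ⟨
  2 ^ (4 * suc c)                                    ∎
  where
  open ≤-Reasoning
  expand : ∀ c → suc c * (6 + 4 * c) + suc (9 + c * (22 + 60 * c)) ≡ 16 * suc (c * (2 + 4 * c))
  expand = solve-∀

*[2+]<2^ : ∀ c {j} → 4 * c ≤′ j → c * (2 + j) < 2 ^ j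
*[2+]<2^ c ≤′-refl = *[2+4*]<2^4* c
*[2+]<2^ c {suc j} (≤′-step 4c≤j) = begin-strict
  c * (2 + suc j)      ≡⟨ *-suc c (2 + j) ⟩
  c + c * (2 + j)      <⟨ +-monoʳ-< c (*[2+]<2^ c 4c≤j) ⟩
  c + 2 ^ j            ≤⟨ +-monoˡ-≤ (2 ^ j) (≤-trans (m≤m*n c (2 + j)) (<⇒≤ (*[2+]<2^ c 4c≤j))) ⟩
  2 ^ j + 2 ^ j        ≡⟨ 2^suc≡2^+2^ j ⟨
  2 ^ suc j            ∎
  where open ≤-Reasoning

-- suc p * suc n ≤ count A (suc n) * suc d  says  ratio A n ≥ (p+1)/(d+1).
DensityZero : Subset → Set
DensityZero A = ∀ p d → ∃ λ m → ∀ n → suc p * suc n ≤ count A (suc n) * suc d → n < m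

logCount⇒DensityZero : ∀ A c → (∀ j → count A (2 ^ j) ≤ 1 + j * c) → DensityZero A
logCount⇒DensityZero A c log-bound p d =
  2 ^ (4 * c′) , λ n dense → ≰⇒> λ 2^≤n → <⇒≱ (sparse n 2^≤n) dense
  where
  c′ = suc d * suc c
  sparse : ∀ n → 2 ^ (4 * c′) ≤ n → count A (suc n) * suc d < suc p * suc n
  sparse n 2^≤n with dyadicBlock n
  ... | j , 2^j≤N , N<2^j+1 = begin-strict
    count A (suc n) * suc d        ≤⟨ *-monoˡ-≤ (suc d) (count-mono A (<⇒≤ N<2^j+1)) ⟩
    count A (2 ^ suc j) * suc d    ≤⟨ *-monoˡ-≤ (suc d) (log-bound (suc j)) ⟩
    (1 + suc j * c) * suc d        ≤⟨ m≤m+n _ (suc d * (c + j + 1)) ⟩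
    (1 + suc j * c) * suc d + suc d * (c + j + 1) ≡⟨ expand c d j ⟩
    c′ * (2 + j)                   <⟨ *[2+]<2^ c′ (≤⇒≤′ 4c′≤j) ⟩
    2 ^ j                          ≤⟨ 2^j≤N ⟩
    suc n                          ≤⟨ m≤m+n (suc n) (p * suc n) ⟩
    suc p * suc n                  ∎
    where
    open ≤-Reasoning
    expand : ∀ c d j → (1 + suc j * c) * suc d + suc d * (c + j + 1) ≡ suc d * suc c * (2 + j)
    expand = solve-∀
    4c′≤j : 4 * c′ ≤ j
    4c′≤j = begin
      4 * c′                       ≡⟨ ⌊log₂[2^n]⌋≡n (4 * c′) ⟨
      ⌊log₂ (2 ^ (4 * c′)) ⌋       ≤⟨ ⌊log₂⌋-mono-≤ (m≤n⇒m≤1+n 2^≤n) ⟩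
      ⌊log₂ (suc n) ⌋              ≤⟨ ⌊log₂⌋≤ j N<2^j+1 ⟩
      j                            ∎

dyadicBoundary-densityZero : ∀ K → DensityZero (dyadicBoundary K)
dyadicBoundary-densityZero K = logCount⇒DensityZero (dyadicBoundary K) (K + K) (count-dyadicBoundary K)

shift-source : ∀ m k {j} → ℤ.+ m ℤ.- k ≡ ℤ.+ j → m ∸ ℤ.∣ k ∣ ≤ j × j ≤ m + ℤ.∣ k ∣
shift-source m -[1+ K ] eq with ℤ.+-injective eq
... | refl = ≤-trans (m∸n≤m m (suc K)) (m≤m+n m (suc K)) , ≤-refl
shift-source m (ℤ.+ K) {j} eq =
  ≤-reflexive m∸K≡j , subst (_≤ m + K) m∸K≡j (≤-trans (m∸n≤m m K) (m≤m+n m K))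
  where
  m≡j+K : m ≡ j + K
  m≡j+K = ℤ.+-injective (begin
    ℤ.+ m                    ≡⟨ //-rightDividesˡ (ℤ.+ K) (ℤ.+ m) ⟨
    ℤ.+ m ℤ.- ℤ.+ K ℤ.+ ℤ.+ K ≡⟨ cong (ℤ._+ ℤ.+ K) eq ⟩
    ℤ.+ (j + K)              ∎)
    where open ≡-Reasoning
  m∸K≡j : m ∸ K ≡ j
  m∸K≡j = trans (cong (_∸ K) m≡j+K) (m+n∸n≡m j K)

∈shift⇒near : ∀ A k m → m ∈ shift A k → ∃ λ j → j ∈ A × m ∸ ℤ.∣ k ∣ ≤ j × j ≤ m + ℤ.∣ k ∣
∈shift⇒near A k m m∈ with ℤ.+ m ℤ.- k in eq
... | ℤ.+ j = j , m∈ , shift-source m k eq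

⌊log₂⌋-squeeze : ∀ {a b x} → a ≤ x → x ≤ b → ⌊log₂ a ⌋ ≡ ⌊log₂ b ⌋ → ⌊log₂ x ⌋ ≡ ⌊log₂ b ⌋
⌊log₂⌋-squeeze a≤x x≤b log-a≡log-b =
  ≤-antisym (⌊log₂⌋-mono-≤ x≤b) (subst (_≤ _) log-a≡log-b (⌊log₂⌋-mono-≤ a≤x))

shift-dyadicUnion-⊆ : ∀ f k → shift (dyadicUnion f) k ⊆ (dyadicUnion f ∪ dyadicBoundary ℤ.∣ k ∣)
shift-dyadicUnion-⊆ f k m m∈ with ∈shift⇒near (dyadicUnion f) k m m∈
... | j , j∈ , m∸K≤j , j≤m+K with ⌊log₂ (m ∸ ℤ.∣ k ∣) ⌋ ≟ ⌊log₂ (m + ℤ.∣ k ∣) ⌋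
...   | no _  = ∨-zeroʳ (f ⌊log₂ m ⌋)
...   | yes e = cong (_∨ false) (trans (cong f log-m≡log-j) j∈)
  where
  log-m≡log-j : ⌊log₂ m ⌋ ≡ ⌊log₂ j ⌋
  log-m≡log-j = trans (⌊log₂⌋-squeeze (m∸n≤m m ℤ.∣ k ∣) (m≤m+n m ℤ.∣ k ∣) e)
                      (sym (⌊log₂⌋-squeeze m∸K≤j j≤m+K e))

∣ratio∣≡ratio : ∀ c n → ℚ.∣ ℤ.+ c ℚ./ suc n ℚ.- 0ℚ ∣ ≡ ℤ.+ c ℚ./ suc n
∣ratio∣≡ratio c n = trans (cong ℚ.∣_∣ (ℚ.+-identityʳ _))
  (ℚ.0≤p⇒∣p∣≡p (ℚ.nonNegative⁻¹ _ {{ℚ.normalize-nonNeg c (suc n)}}))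

≤∣ratio∣⇔ : ∀ p d .(cop : Coprime (suc p) (suc d)) c n →
            (mkℚ +[1+ p ] d cop ≤ℚ ℚ.∣ ℤ.+ c ℚ./ suc n ℚ.- 0ℚ ∣) ⇔ (suc p * suc n ≤ c * suc d)
≤∣ratio∣⇔ p d cop c n = mk⇔
  (λ ε≤ → to (ℚᵘ.≤-respʳ-≃ x≃ (ℚ.toℚᵘ-mono-≤ (subst (ε ≤ℚ_) (∣ratio∣≡ratio c n) ε≤))))
  (λ ≤ → subst (ε ≤ℚ_) (sym (∣ratio∣≡ratio c n)) (ℚ.toℚᵘ-cancel-≤ (ℚᵘ.≤-respʳ-≃ (ℚᵘ.≃-sym x≃) (from ≤))))
  where
  ε = mkℚ +[1+ p ] d cop
  x≃ : toℚᵘ (ℤ.+ c ℚ./ suc n) ℚᵘ.≃ ℚᵘ.mkℚᵘ (ℤ.+ c) n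
  x≃ = ℚ.toℚᵘ-fromℚᵘ (ℚᵘ.mkℚᵘ (ℤ.+ c) n)
  to : toℚᵘ ε ℚᵘ.≤ ℚᵘ.mkℚᵘ (ℤ.+ c) n → suc p * suc n ≤ c * suc d
  to (ℚᵘ.*≤* ≤) = ℤ.drop‿+≤+ (subst (_ ℤ.≤_) (sym (ℤ.pos-* c (suc d))) ≤)
  from : suc p * suc n ≤ c * suc d → toℚᵘ ε ℚᵘ.≤ ℚᵘ.mkℚᵘ (ℤ.+ c) n
  from ≤ = ℚᵘ.*≤* (subst (_ ℤ.≤_) (ℤ.pos-* c (suc d)) (ℤ.+≤+ ≤))

DensityZero⇒Zδ : ∀ {J} → IsIdeal J → ∀ A → DensityZero A → Zδ J A
DensityZero⇒Zδ idealJ A A-dz (mkℚ +[1+ p ] d cop) _ with A-dz p d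
... | m , bounded = IsIdeal.finite-in idealJ _ (m , λ n n∈ → bounded n
  (Equivalence.to (≤∣ratio∣⇔ p d cop (count A (suc n)) n) (toWitness (Equivalence.from T-≡ n∈))))

eventuallyDense⇒¬Zδ : ∀ {J} → IsIdeal J → ∀ A d m →
                   (∀ n → m ≤ n → suc n ≤ count A (suc n) * suc d) → ¬ Zδ J A
eventuallyDense⇒¬Zδ {J} idealJ A d m dense A∈Zδ = IsIdeal.proper idealJ
  (IsIdeal.subset-closed idealJ fullℕ (large ∪ initial) covers
    (IsIdeal.union-closed idealJ large initial (A∈Zδ ε _) initial∈J))
  where
  ε = mkℚ (ℤ.+ 1) d (1-coprimeTo (suc d))
  large : Subset
  large n = ⌊ ε ℚ.≤? ℚ.∣ ratio A n ℚ.- 0ℚ ∣ ⌋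
  initial : Subset
  initial n = n <ᵇ m
  initial∈J : J initial
  initial∈J = IsIdeal.finite-in idealJ initial (m , λ n n∈ → <ᵇ⇒< n m (Equivalence.from T-≡ n∈))
  covers : fullℕ ⊆ (large ∪ initial)
  covers n _ with n <? m
  ... | yes n<m = trans (cong (large n ∨_) (Equivalence.to T-≡ (<⇒<ᵇ n<m))) (∨-zeroʳ (large n))
  ... | no n≮m = cong (_∨ initial n) (Equivalence.to T-≡ (fromWitness (Equivalence.from
                   (≤∣ratio∣⇔ 0 d _ (count A (suc n)) n) (1*N≤ n (≮⇒≥ n≮m)))))
    where
    1*N≤ : ∀ n → m ≤ n → 1 * suc n ≤ count A (suc n) * suc d
    1*N≤ n m≤n = subst (_≤ count A (suc n) * suc d) (sym (*-identityˡ (suc n))) (dense n m≤n)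

evenᵇ : ℕ → Bool
evenᵇ zero    = true
evenᵇ (suc n) = not (evenᵇ n)

b-or-not-b : ∀ b → b ≡ true ⊎ not b ≡ true
b-or-not-b true  = inj₁ refl
b-or-not-b false = inj₂ refl

theorem3p12 : (J : Family) → IsMaximalIdeal J →
                (I : Family) → IsMaximalIdeal I → ¬ (Zδ J ≐ t I)
theorem3p12 J (idealJ , _) I maximalI@(idealI , _) Zδ≐tI =
  dyadicUnion∉I (not ∘ evenᵇ) (b-or-not-b ∘ not ∘ evenᵇ)
    (maximal⇒∁∈ maximalI (dyadicUnion evenᵇ) (dyadicUnion∉I evenᵇ (b-or-not-b ∘ evenᵇ)))
  where
  open IsIdeal idealI
  boundary∈I : ∀ K → I (dyadicBoundary K)
  boundary∈I K = t⊆ idealI ∂ (proj₁ (Zδ≐tI ∂) (DensityZero⇒Zδ idealJ ∂ (dyadicBoundary-densityZero K)))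
    where ∂ = dyadicBoundary K
  dyadicUnion∈t : ∀ f → I (dyadicUnion f) → t I (dyadicUnion f)
  dyadicUnion∈t f X∈I k = subset-closed (shift X k) (X ∪ ∂) (shift-dyadicUnion-⊆ f k)
                             (union-closed X ∂ X∈I (boundary∈I ℤ.∣ k ∣))
    where X = dyadicUnion f; ∂ = dyadicBoundary ℤ.∣ k ∣
  dyadicUnion∉I : ∀ f → (∀ j → f j ≡ true ⊎ f (suc j) ≡ true) → ¬ I (dyadicUnion f)
  dyadicUnion∉I f often X∈I =
    eventuallyDense⇒¬Zδ idealJ (dyadicUnion f) 7 3 (dyadicUnion-dense f often)
      (proj₂ (Zδ≐tI (dyadicUnion f)) (dyadicUnion∈t f X∈I))
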